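{- Let $U_0,U_1,U_2,\ldots$ and $V_0,V_1,V_2,\ldots$ be two sequences of elements of an arbitrary commutative overring of $\mathbb{K}[X_1^{ -1},X_1,X_2,\ldots]$, and let $(Q_{n,k})$ be a regular B-representable family of polynomials with orthogonal companion $Q^{\perp}_{n,k}=A_{n,k}(Q_{1,1},\ldots,Q_{n-k+1,1})$. Then the following are equivalent: (i) $U_n=\sum_{k=0}^nQ_{n,k}V_k$ for all $n\ge0$; (ii) $V_n=\sum_{k=0}^nQ^{\perp}_{n,k}U_k$ for all $n\ge0$.
   Context: $\mathbb{K}$ is a field of characteristic zero. Partial Bell polynomials: $B_{0,0}=1$, $B_{n,0}=0$ ($n\ge1$), $B_{n,k}=0$ ($k>n$), and for $1\le k\le n$, $B_{n,k}=\sum\frac{n!}{\prod_ir_i!(i!)^{r_i}}\prod_iX_i^{r_i}$ over non-negative integers $r_i$ with $\sum r_i=k$, $\sum ir_i=n$. $A_{n,k}\in\mathbb{K}[X_1^{ -1},X_1,X_2,\ldots]$ is the unique lower triangular family with $A_{0,0}=1$, $A_{n,0}=0$ ($n\ge1$) and $\sum_{j=k}^nA_{n,j}B_{j,k}=\delta_{nk}$ for $0\le k\le n$. A polynomial family $(Q_{n,k})_{n,k\ge0}$ is B-representable if $Q_{n,k}=0$ for $k>n$, $Q_{0,0}=1$, $Q_{n,0}=0$ for $n\ge1$ (as for $B_{n,k}$), and there exist polynomials $H_1,H_2,\ldots$ with $Q_{n,k}=B_{n,k}(H_1,\ldots,H_{n-k+1})$ for $1\le k\le n$; it is regular if all its finite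 lower triangular matrices $(Q_{i,j})_{0\le i,j\le n}$ are nonsingular. $P(H_1,H_2,\ldots)$ denotes substitution of $H_j$ for $X_j$. -}

module Defs where

open import Level using (Level; _⊔_) renaming (suc to lsuc)
open import Data.Nat as ℕ using (ℕ; zero; suc; _∸_; _≤?_; _≟_; NonZero)
open import Data.Nat.Properties using (m*n≢0; _!≢0; m^n≢0)
open import Data.Nat.DivMod using (_/_)
open import Data.List using (List; []; _∷_; map; concatMap; upTo; foldr)
open import Data.Bool using (Bool; true; false; if_then_else_; _∧_)
open import Data.Product using (Σ; _×_; _,_)
open import Data.Fin using (Fin; toℕ)
open import Relation.Nullary using (¬_; yes; no)
open import Relation.Nullary.Decidable using (⌊_⌋)
open import Algebra.Bundles using (CommutativeRing)
open import Algebra.Morphism.Structures using (module RingMorphisms)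

allLists : ℕ → ℕ → List (List ℕ)
allLists zero    b = [] ∷ []
allLists (suc n) b = concatMap (λ r → map (r ∷_) (allLists n b)) (upTo (suc b))

-- a list rs = (r_i, r_{i+1}, …) whose first entry is the exponent of X_i
sumR : List ℕ → ℕ
sumR = foldr ℕ._+_ 0

weightR : ℕ → List ℕ → ℕ
weightR i []       = 0
weightR i (r ∷ rs) = i ℕ.* r ℕ.+ weightR (suc i) rs

denom : ℕ → List ℕ → ℕ
denom i []       = 1
denom i (r ∷ rs) = (r ℕ.! ℕ.* ((i ℕ.!) ℕ.^ r)) ℕ.* denom (suc i) rs

denom≢0 : ∀ i rs → NonZero (denom i rs)
denom≢0 i []       = _
denom≢0 i (r ∷ rs) =
  m*n≢0 _ _ {{m*n≢0 _ _ {{r !≢0}} {{m^n≢0 (i ℕ.!) r {{i !≢0}}}}}} {{denom≢0 (suc i) rs}}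

bellCoeff : ℕ → List ℕ → ℕ
bellCoeff n rs = (n ℕ.! / denom 1 rs) {{denom≢0 1 rs}}

module RingOps {c ℓ : Level} (R : CommutativeRing c ℓ) where
  open CommutativeRing R

  infixr 8 _·ℕ_
  _·ℕ_ : ℕ → Carrier → Carrier
  zero  ·ℕ a = 0#
  suc n ·ℕ a = a + n ·ℕ a

  infixr 9 _^_
  _^_ : Carrier → ℕ → Carrier
  a ^ zero  = 1#
  a ^ suc n = a * a ^ n

  ∑≤ : ℕ → (ℕ → Carrier) → Carrier
  ∑≤ zero    f = f 0
  ∑≤ (suc n) f = ∑≤ n f + f (suc n)

  ∑L : {A : Set} → List A → (A → Carrier) → Carrier
  ∑L []       f = 0#
  ∑L (a ∷ as) f = f a + ∑L as f

  mono : (ℕ → Carrier) → ℕ → List ℕ → Carrier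
  mono x i []       = 1#
  mono x i (r ∷ rs) = x i ^ r * mono x (suc i) rs

  -- the explicit Bell sum, valid for 1 ≤ k ≤ n, evaluated at
  -- X_i ↦ x i  (i ≥ 1; x 0 is never used):
  -- Σ over (r_1,…,r_n) ∈ ℕⁿ with Σ r_i = k, Σ i r_i = n of
  --   n!/(Π r_i! (i!)^{r_i}) Π x_i^{r_i}
  -- (every such r has r_i ≤ n, so enumerating entries in {0,…,n} is exhaustive)
  bellSum : (ℕ → Carrier) → ℕ → ℕ → Carrier
  bellSum x n k = ∑L (allLists n n) λ rs →
    if ⌊ sumR rs ≟ k ⌋ ∧ ⌊ weightR 1 rs ≟ n ⌋
      then bellCoeff n rs ·ℕ mono x 1 rs
      else 0#

  Bell : (ℕ → Carrier) → ℕ → ℕ → Carrier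
  Bell x zero    zero    = 1#
  Bell x (suc n) zero    = 0#
  Bell x n       (suc k) with suc k ≤? n
  ... | yes _ = bellSum x n (suc k)
  ... | no  _ = 0#

  -- A_{n,k}(x_1, x_2, …) with X_1^{-1} ↦ xinv.
  -- Solving Σ_{j=k}^n A_{n,j} B_{j,k} = δ_{nk} for A_{n,k} (B_{k,k} = X_1^k):
  --   A_{n,n} = X_1^{-n},
  --   A_{n,k} = - X_1^{-k} Σ_{j=k+1}^{n} A_{n,j} B_{j,k}   (k < n).
  -- Atab x xinv n d e = A_{n, n∸e} for e ≤ d (and 0 for e > d).
  Atab : (ℕ → Carrier) → Carrier → ℕ → ℕ → ℕ → Carrier
  Atab x xinv n zero e with e ≟ 0
  ... | yes _ = xinv ^ n
  ... | no  _ = 0#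
  Atab x xinv n (suc d) e with e ℕ.≤? d | e ≟ suc d
  ... | yes _ | _     = Atab x xinv n d e
  ... | no  _ | yes _ =
        - (xinv ^ (n ∸ suc d) *
           ∑≤ d (λ e′ → Atab x xinv n d e′ * Bell x (n ∸ e′) (n ∸ suc d)))
  ... | no  _ | no  _ = 0#

  AFam : (ℕ → Carrier) → Carrier → ℕ → ℕ → Carrier
  AFam x xinv n k with k ≤? n
  ... | yes _ = Atab x xinv n (n ∸ k) (n ∸ k)
  ... | no  _ = 0#

  record BRepresentable (Q : ℕ → ℕ → Carrier) : Set (c ⊔ ℓ) where
    field
      upper0 : ∀ n k → n ℕ.< k → Q n k ≈ 0#
      q00    : Q 0 0 ≈ 1#
      qn0    : ∀ n → Q (suc n) 0 ≈ 0#
      H      : ℕ → Carrier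
      repr   : ∀ n k → 1 ℕ.≤ k → k ℕ.≤ n → Q n k ≈ Bell H n k

  matMul : ∀ n → (Fin (suc n) → Fin (suc n) → Carrier)
               → (Fin (suc n) → Fin (suc n) → Carrier)
               → Fin (suc n) → Fin (suc n) → Carrier
  matMul n M N i j = ∑Fin n (λ l → M i l * N l j)
    where
    ∑Fin : ∀ m → (Fin (suc m) → Carrier) → Carrier
    ∑Fin zero    f = f Fin.zero
    ∑Fin (suc m) f = f Fin.zero + ∑Fin m (λ l → f (Fin.suc l))

  idMat : ∀ n → Fin (suc n) → Fin (suc n) → Carrier
  idMat n i j with toℕ i ≟ toℕ j
  ... | yes _ = 1#
  ... | no  _ = 0#

  Nonsingular : ∀ n → (Fin (suc n) → Fin (suc n) → Carrier) → Set (c ⊔ ℓ)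
  Nonsingular n M = Σ (Fin (suc n) → Fin (suc n) → Carrier) λ N →
    (∀ i j → matMul n M N i j ≈ idMat n i j) × (∀ i j → matMul n N M i j ≈ idMat n i j)

  Regular : (ℕ → ℕ → Carrier) → Set (c ⊔ ℓ)
  Regular Q = ∀ n → Nonsingular n (λ i j → Q (toℕ i) (toℕ j))

record IsField {k kℓ : Level} (K : CommutativeRing k kℓ) : Set (k ⊔ kℓ) where
  open CommutativeRing K
  field
    1≉0 : ¬ (1# ≈ 0#)
    inv : ∀ a → ¬ (a ≈ 0#) → Σ Carrier λ b → a * b ≈ 1#

CharZero : {k kℓ : Level} (K : CommutativeRing k kℓ) → Set kℓ
CharZero K = ∀ n → ¬ (suc n ·ℕ 1# ≈ 0#)
  where open CommutativeRing K
        open RingOps K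

-- P together with ιK : 𝕂 → P, X : ℕ → P (X i = X_i for i ≥ 1; X 0 unused)
-- and Xinv = X_1^{-1} is the Laurent-type polynomial ring
-- 𝕂[X_1^{-1}, X_1, X_2, …], characterised by its universal property:
-- for every commutative 𝕂-algebra S and every s_1, s_2, … ∈ S with s_1
-- invertible there is exactly one 𝕂-algebra homomorphism P → S with X_i ↦ s_i.

module _ {k kℓ p pℓ : Level} (K : CommutativeRing k kℓ) (P : CommutativeRing p pℓ) where
  private
    module K = CommutativeRing K
    module P = CommutativeRing P

  IsRingHom : ∀ {s sℓ} (S₁ : CommutativeRing s sℓ) {t tℓ} (S₂ : CommutativeRing t tℓ)
            → (CommutativeRing.Carrier S₁ → CommutativeRing.Carrier S₂) → Set _
  IsRingHom S₁ S₂ f = RingMorphisms.IsRingHomomorphism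
    (CommutativeRing.rawRing S₁) (CommutativeRing.rawRing S₂) f

  record IsLaurentPolyRing (ιK : K.Carrier → P.Carrier) (X : ℕ → P.Carrier)
                           (Xinv : P.Carrier) : Set (lsuc (p ⊔ pℓ) ⊔ k ⊔ kℓ) where
    field
      ιK-hom    : IsRingHom K P ιK
      X₁-inv    : X 1 P.* Xinv P.≈ P.1#
      existence : (S : CommutativeRing p pℓ) →
                  let module S = CommutativeRing S in
                  (f : K.Carrier → S.Carrier) → IsRingHom K S f →
                  (s : ℕ → S.Carrier) (sinv : S.Carrier) → s 1 S.* sinv S.≈ S.1# →
                  Σ (P.Carrier → S.Carrier) λ φ →
                    IsRingHom P S φ × (∀ a → φ (ιK a) S.≈ f a)
                                    × (∀ i → φ (X (suc i)) S.≈ s (suc i))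
      uniqueness : (S : CommutativeRing p pℓ) →
                  let module S = CommutativeRing S in
                  (f : K.Carrier → S.Carrier) →
                  (s : ℕ → S.Carrier) →
                  (φ ψ : P.Carrier → S.Carrier) →
                  IsRingHom P S φ → (∀ a → φ (ιK a) S.≈ f a)
                                  → (∀ i → φ (X (suc i)) S.≈ s (suc i)) →
                  IsRingHom P S ψ → (∀ a → ψ (ιK a) S.≈ f a)
                                  → (∀ i → ψ (X (suc i)) S.≈ s (suc i)) →
                  ∀ q → φ q S.≈ ψ q

-- R is a commutative overring of P: an injective ring homomorphism ι : P → R

IsOverring : {p pℓ r rℓ : Level} (P : CommutativeRing p pℓ) (R : CommutativeRing r rℓ)
           → (CommutativeRing.Carrier P → CommutativeRing.Carrier R) → Set _
IsOverring P R ι = RingMorphisms.IsRingMonomorphism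
  (CommutativeRing.rawRing P) (CommutativeRing.rawRing R) ι

OrthCompanion : {p pℓ : Level} (P : CommutativeRing p pℓ)
              → (ℕ → ℕ → CommutativeRing.Carrier P) → CommutativeRing.Carrier P
              → ℕ → ℕ → CommutativeRing.Carrier P
OrthCompanion P Q q11inv = RingOps.AFam P (λ j → Q j 1) q11inv

Expansion : {p pℓ r rℓ : Level} (P : CommutativeRing p pℓ) (R : CommutativeRing r rℓ)
          → (CommutativeRing.Carrier P → CommutativeRing.Carrier R)
          → (ℕ → ℕ → CommutativeRing.Carrier P)
          → (W Z : ℕ → CommutativeRing.Carrier R) → Set rℓ
Expansion P R ι M W Z = ∀ n → W n ≈ ∑≤ n (λ k → ι (M n k) * Z k)
  where open CommutativeRing R
        open RingOps R

-- Put x_j = Q_{j,1}. Since B_{n,1}(H) = H_n, B-representability says Q_{n,k} = B_{n,k}(x),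
-- and A(x) is constructed as a left inverse of the lower triangular matrix B(x), whose
-- diagonal B_{k,k}(x) = x_1^k is invertible. So Q^⊥ Q = I: multiplying (i) by Q^⊥ gives (ii).
-- Conversely, if (ii) holds then W = QV satisfies Q^⊥ W = V = Q^⊥ U by the first half, and
-- Q^⊥ is injective on sequences because it is lower triangular with invertible diagonal
-- (Q^⊥_{n,n} Q_{n,n} = 1), so U = W.
module Submission where

open import Defs
open import Level using (Level)
open import Data.Nat as ℕ using (ℕ; zero; suc; _≤_; _<_; z≤n; s≤s; _∸_; _≤?_; _≟_)
open import Data.Nat.Properties as ℕₚ using ()
open import Data.Nat.DivMod using (_/_; n/n≡1)
open import Data.List using (List; []; _∷_; map; concatMap; upTo; _++_; length; replicate)
open import Data.List.Properties using (applyUpTo-∷ʳ; length-replicate; ∷-injective; ∷-injectiveˡ)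
open import Data.List.Relation.Unary.All using (All; []; _∷_)
open import Data.Bool using (true; false; if_then_else_; _∧_)
open import Data.Sum using (inj₁; inj₂)
open import Data.Product using (_×_; _,_; proj₂)
open import Data.Empty using (⊥-elim)
open import Function using (_∘_)
open import Relation.Nullary using (¬_; Dec; yes; no)
open import Relation.Nullary.Decidable using (⌊_⌋)
open import Relation.Binary.PropositionalEquality as ≡ using (_≡_; _≢_)
open import Algebra.Bundles using (CommutativeRing)
open import Algebra.Morphism.Structures using (module RingMorphisms)
open import Function.Bundles using (_⇔_; mk⇔)

module Sums {c ℓ : Level} (R : CommutativeRing c ℓ) where
  open CommutativeRing R
  open RingOps R
  open import Algebra.Properties.CommutativeSemigroup +-commutativeSemigroup
    using (interchange)
  open import Relation.Binary.Reasoning.Setoid setoid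

  ∑≤-cong : ∀ n {f g : ℕ → Carrier} → (∀ i → i ≤ n → f i ≈ g i) → ∑≤ n f ≈ ∑≤ n g
  ∑≤-cong zero    f≈g = f≈g 0 z≤n
  ∑≤-cong (suc n) f≈g =
    +-cong (∑≤-cong n (λ i i≤n → f≈g i (ℕₚ.m≤n⇒m≤1+n i≤n))) (f≈g (suc n) ℕₚ.≤-refl)

  ∑≤-zero : ∀ n {f : ℕ → Carrier} → (∀ i → i ≤ n → f i ≈ 0#) → ∑≤ n f ≈ 0#
  ∑≤-zero zero    f≈0 = f≈0 0 z≤n
  ∑≤-zero (suc n) f≈0 = trans
    (+-cong (∑≤-zero n (λ i i≤n → f≈0 i (ℕₚ.m≤n⇒m≤1+n i≤n))) (f≈0 (suc n) ℕₚ.≤-refl))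
    (+-identityʳ 0#)

  ∑≤-last : ∀ n {f : ℕ → Carrier} → (∀ i → i < n → f i ≈ 0#) → ∑≤ n f ≈ f n
  ∑≤-last zero    _   = refl
  ∑≤-last (suc n) f≈0 =
    trans (+-congʳ (∑≤-zero n (λ i i≤n → f≈0 i (s≤s i≤n)))) (+-identityˡ _)

  ∑≤-truncate : ∀ d n {f : ℕ → Carrier} → d ≤ n →
                (∀ i → d < i → i ≤ n → f i ≈ 0#) → ∑≤ n f ≈ ∑≤ d f
  ∑≤-truncate d zero    z≤n _   = refl
  ∑≤-truncate d (suc n) d≤1+n f≈0 with ℕₚ.m≤n⇒m<n∨m≡n d≤1+n
  ... | inj₂ ≡.refl      = refl
  ... | inj₁ (s≤s d≤n) = trans
    (+-cong (∑≤-truncate d n d≤n (λ i d<i i≤n → f≈0 i d<i (ℕₚ.m≤n⇒m≤1+n i≤n)))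
            (f≈0 (suc n) (s≤s d≤n) ℕₚ.≤-refl))
    (+-identityʳ _)

  ∑≤-single : ∀ n t {f : ℕ → Carrier} → t ≤ n → (∀ i → i ≢ t → f i ≈ 0#) → ∑≤ n f ≈ f t
  ∑≤-single n t t≤n f≈0 = trans
    (∑≤-truncate t n t≤n (λ i t<i _ → f≈0 i (ℕₚ.>⇒≢ t<i)))
    (∑≤-last t (λ i i<t → f≈0 i (ℕₚ.<⇒≢ i<t)))

  ∑≤-distrib-+ : ∀ n (f g : ℕ → Carrier) → ∑≤ n (λ i → f i + g i) ≈ ∑≤ n f + ∑≤ n g
  ∑≤-distrib-+ zero    f g = refl
  ∑≤-distrib-+ (suc n) f g =
    trans (+-congʳ (∑≤-distrib-+ n f g)) (interchange _ _ _ _)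

  ∑≤-distribˡ-* : ∀ n a (f : ℕ → Carrier) → a * ∑≤ n f ≈ ∑≤ n (λ i → a * f i)
  ∑≤-distribˡ-* zero    a f = refl
  ∑≤-distribˡ-* (suc n) a f = trans (distribˡ a _ _) (+-congʳ (∑≤-distribˡ-* n a f))

  ∑≤-distribʳ-* : ∀ n a (f : ℕ → Carrier) → ∑≤ n f * a ≈ ∑≤ n (λ i → f i * a)
  ∑≤-distribʳ-* zero    a f = refl
  ∑≤-distribʳ-* (suc n) a f = trans (distribʳ a _ _) (+-congʳ (∑≤-distribʳ-* n a f))

  ∑≤-comm : ∀ m n (f : ℕ → ℕ → Carrier) →
            ∑≤ m (λ i → ∑≤ n (f i)) ≈ ∑≤ n (λ j → ∑≤ m (λ i → f i j))
  ∑≤-comm zero    n f = refl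
  ∑≤-comm (suc m) n f = trans (+-congʳ (∑≤-comm m n f))
    (sym (∑≤-distrib-+ n (λ j → ∑≤ m (λ i → f i j)) (f (suc m))))

  ∑≤-reverse : ∀ n (f : ℕ → Carrier) → ∑≤ n f ≈ ∑≤ n (λ i → f (n ∸ i))
  ∑≤-reverse zero    f = refl
  ∑≤-reverse (suc n) f = begin
    ∑≤ n f + f (suc n)                          ≈⟨ +-comm _ _ ⟩
    f (suc n) + ∑≤ n f                          ≈⟨ +-congˡ (∑≤-reverse n f) ⟩
    f (suc n) + ∑≤ n (λ i → f (n ∸ i))          ≈⟨ ∑≤-cons n (λ i → f (suc n ∸ i)) ⟨
    ∑≤ (suc n) (λ i → f (suc n ∸ i))            ∎
    where
    ∑≤-cons : ∀ m (g : ℕ → Carrier) → ∑≤ (suc m) g ≈ g 0 + ∑≤ m (g ∘ suc)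
    ∑≤-cons zero    g = refl
    ∑≤-cons (suc m) g = trans (+-congʳ (∑≤-cons m g)) (+-assoc _ _ _)

  ∑L-++ : ∀ {A : Set} (xs ys : List A) f → ∑L (xs ++ ys) f ≈ ∑L xs f + ∑L ys f
  ∑L-++ []       ys f = sym (+-identityˡ _)
  ∑L-++ (x ∷ xs) ys f = trans (+-congˡ (∑L-++ xs ys f)) (sym (+-assoc _ _ _))

  ∑L-cong : ∀ {A : Set} (xs : List A) {f g : A → Carrier} → (∀ a → f a ≈ g a) →
            ∑L xs f ≈ ∑L xs g
  ∑L-cong []       f≈g = refl
  ∑L-cong (x ∷ xs) f≈g = +-cong (f≈g x) (∑L-cong xs f≈g)

  ∑L-map : ∀ {A B : Set} (g : A → B) (xs : List A) f → ∑L (map g xs) f ≈ ∑L xs (f ∘ g)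
  ∑L-map g []       f = refl
  ∑L-map g (x ∷ xs) f = +-congˡ (∑L-map g xs f)

  ∑L-concatMap : ∀ {A B : Set} (F : A → List B) (xs : List A) f →
                 ∑L (concatMap F xs) f ≈ ∑L xs (λ a → ∑L (F a) f)
  ∑L-concatMap F []       f = refl
  ∑L-concatMap F (x ∷ xs) f =
    trans (∑L-++ (F x) (concatMap F xs) f) (+-congˡ (∑L-concatMap F xs f))

  ∑L-upTo : ∀ n (f : ℕ → Carrier) → ∑L (upTo (suc n)) f ≈ ∑≤ n f
  ∑L-upTo zero    f = +-identityʳ (f 0)
  ∑L-upTo (suc n) f = begin
    ∑L (upTo (suc (suc n))) f              ≡⟨ ≡.cong (λ xs → ∑L xs f) (applyUpTo-∷ʳ (λ i → i) (suc n)) ⟨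
    ∑L (upTo (suc n) ++ suc n ∷ []) f      ≈⟨ ∑L-++ (upTo (suc n)) (suc n ∷ []) f ⟩
    ∑L (upTo (suc n)) f + (f (suc n) + 0#) ≈⟨ +-cong (∑L-upTo n f) (+-identityʳ _) ⟩
    ∑≤ n f + f (suc n)                     ∎

  ∑L-allLists-suc : ∀ m b (f : List ℕ → Carrier) →
    ∑L (allLists (suc m) b) f ≈ ∑≤ b (λ r → ∑L (allLists m b) (λ rs → f (r ∷ rs)))
  ∑L-allLists-suc m b f = begin
    ∑L (concatMap (λ r → map (r ∷_) (allLists m b)) (upTo (suc b))) f
      ≈⟨ ∑L-concatMap (λ r → map (r ∷_) (allLists m b)) (upTo (suc b)) f ⟩
    ∑L (upTo (suc b)) (λ r → ∑L (map (r ∷_) (allLists m b)) f)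
      ≈⟨ ∑L-cong (upTo (suc b)) (λ r → ∑L-map (r ∷_) (allLists m b) f) ⟩
    ∑L (upTo (suc b)) (λ r → ∑L (allLists m b) (λ rs → f (r ∷ rs)))
      ≈⟨ ∑L-upTo b _ ⟩
    ∑≤ b (λ r → ∑L (allLists m b) (λ rs → f (r ∷ rs)))
      ∎

  ∑L-allLists-zero : ∀ m b (f : List ℕ → Carrier) →
    (∀ rs → length rs ≡ m → f rs ≈ 0#) → ∑L (allLists m b) f ≈ 0#
  ∑L-allLists-zero zero    b f f≈0 = trans (+-identityʳ _) (f≈0 [] ≡.refl)
  ∑L-allLists-zero (suc m) b f f≈0 = trans (∑L-allLists-suc m b f)
    (∑≤-zero b (λ r _ → ∑L-allLists-zero m b _ (λ rs |rs| → f≈0 (r ∷ rs) (≡.cong suc |rs|))))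

  ∑L-allLists-single : ∀ m b (t : List ℕ) (f : List ℕ → Carrier) →
    length t ≡ m → All (_≤ b) t → (∀ rs → length rs ≡ m → rs ≢ t → f rs ≈ 0#) →
    ∑L (allLists m b) f ≈ f t
  ∑L-allLists-single zero    b []      f _    _              _   = +-identityʳ (f [])
  ∑L-allLists-single (suc m) b (r₀ ∷ t) f |t| (r₀≤b ∷ t≤b) f≈0 = begin
    ∑L (allLists (suc m) b) f
      ≈⟨ ∑L-allLists-suc m b f ⟩
    ∑≤ b (λ r → ∑L (allLists m b) (λ rs → f (r ∷ rs)))
      ≈⟨ ∑≤-single b r₀ r₀≤b (λ r r≢r₀ → ∑L-allLists-zero m b _ (λ rs |rs| →
           f≈0 (r ∷ rs) (≡.cong suc |rs|) (r≢r₀ ∘ ∷-injectiveˡ))) ⟩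
    ∑L (allLists m b) (λ rs → f (r₀ ∷ rs))
      ≈⟨ ∑L-allLists-single m b t _ (ℕₚ.suc-injective |t|) t≤b (λ rs |rs| rs≢t →
           f≈0 (r₀ ∷ rs) (≡.cong suc |rs|) (rs≢t ∘ proj₂ ∘ ∷-injective)) ⟩
    f (r₀ ∷ t)
      ∎

module Powers {c ℓ : Level} (R : CommutativeRing c ℓ) where
  open CommutativeRing R
  open RingOps R
  open import Algebra.Properties.CommutativeSemigroup *-commutativeSemigroup
    using (interchange)

  ^-congˡ : ∀ n {a b} → a ≈ b → a ^ n ≈ b ^ n
  ^-congˡ zero    a≈b = refl
  ^-congˡ (suc n) a≈b = *-cong a≈b (^-congˡ n a≈b)

  ^-inverse : ∀ n {a b} → a * b ≈ 1# → a ^ n * b ^ n ≈ 1#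
  ^-inverse zero    ab≈1 = *-identityˡ 1#
  ^-inverse (suc n) ab≈1 = trans (interchange _ _ _ _)
    (trans (*-cong ab≈1 (^-inverse n ab≈1)) (*-identityˡ 1#))

module Triangular {c ℓ : Level} (R : CommutativeRing c ℓ) where
  open CommutativeRing R
  open RingOps R
  open Sums R
  open import Algebra.Properties.Ring ring using (+-cancelˡ)
  open import Relation.Binary.Reasoning.Setoid setoid

  Matrix : Set c
  Matrix = ℕ → ℕ → Carrier

  infixr 7 _⊙_
  _⊙_ : Matrix → (ℕ → Carrier) → ℕ → Carrier
  (M ⊙ v) n = ∑≤ n (λ k → M n k * v k)

  -- The inner sum stops at n: this is the matrix product whenever A is lower triangular.
  infixl 7 _⊛_
  _⊛_ : Matrix → Matrix → Matrix
  (A ⊛ B) n k = ∑≤ n (λ j → A n j * B j k)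

  LowerTriangular : Matrix → Set ℓ
  LowerTriangular M = ∀ j k → j < k → M j k ≈ 0#

  record LeftInverse (A B : Matrix) : Set ℓ where
    field
      diagonal      : ∀ n → (A ⊛ B) n n ≈ 1#
      belowDiagonal : ∀ n k → k < n → (A ⊛ B) n k ≈ 0#

  LeftInverse-congʳ : ∀ {A B B′} → (∀ j k → B j k ≈ B′ j k) →
                      LeftInverse A B → LeftInverse A B′
  LeftInverse-congʳ {A} {B} {B′} B≈B′ A⊛B≈I = record
    { diagonal      = λ n → trans (sym (⊛-congʳ n n)) (diagonal n)
    ; belowDiagonal = λ n k k<n → trans (sym (⊛-congʳ n k)) (belowDiagonal n k k<n)
    }
    where
    open LeftInverse A⊛B≈I
    ⊛-congʳ : ∀ n k → (A ⊛ B) n k ≈ (A ⊛ B′) n k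
    ⊛-congʳ n k = ∑≤-cong n (λ j _ → *-congˡ (B≈B′ j k))

  ⊙-⊛ : ∀ {B} → LowerTriangular B → ∀ A v n → (A ⊙ B ⊙ v) n ≈ ((A ⊛ B) ⊙ v) n
  ⊙-⊛ {B} B-lower A v n = begin
    ∑≤ n (λ j → A n j * ∑≤ j (λ k → B j k * v k))
      ≈⟨ ∑≤-cong n (λ j j≤n → *-congˡ (sym (∑≤-truncate j n j≤n (λ k j<k _ →
           trans (*-congʳ (B-lower j k j<k)) (zeroˡ _))))) ⟩
    ∑≤ n (λ j → A n j * ∑≤ n (λ k → B j k * v k))
      ≈⟨ ∑≤-cong n (λ j _ → ∑≤-distribˡ-* n (A n j) _) ⟩
    ∑≤ n (λ j → ∑≤ n (λ k → A n j * (B j k * v k)))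
      ≈⟨ ∑≤-comm n n _ ⟩
    ∑≤ n (λ k → ∑≤ n (λ j → A n j * (B j k * v k)))
      ≈⟨ ∑≤-cong n (λ k _ → sym (trans (∑≤-distribʳ-* n (v k) _)
           (∑≤-cong n (λ j _ → *-assoc _ _ _)))) ⟩
    ∑≤ n (λ k → (A ⊛ B) n k * v k)
      ∎

  ⊙-identity : ∀ {A B} → LeftInverse A B → ∀ v n → ((A ⊛ B) ⊙ v) n ≈ v n
  ⊙-identity A⊛B≈I v n = trans
    (∑≤-last n (λ k k<n → trans (*-congʳ (belowDiagonal n k k<n)) (zeroˡ _)))
    (trans (*-congʳ (diagonal n)) (*-identityˡ _))
    where open LeftInverse A⊛B≈I

  diagonal-inverse : ∀ {A B} → LowerTriangular B → LeftInverse A B →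
                     ∀ n → A n n * B n n ≈ 1#
  diagonal-inverse B-lower A⊛B≈I n = trans
    (sym (∑≤-last n (λ j j<n → trans (*-congˡ (B-lower j n j<n)) (zeroʳ _))))
    (LeftInverse.diagonal A⊛B≈I n)

  ⊙-injective : ∀ {M u w} (d : ℕ → Carrier) → (∀ n → d n * M n n ≈ 1#) →
                (∀ n → (M ⊙ u) n ≈ (M ⊙ w) n) → ∀ n → u n ≈ w n
  ⊙-injective {M} {u} {w} d dM≈1 Mu≈Mw n = agree n n ℕₚ.≤-refl
    where
    cancel : ∀ n → M n n * u n ≈ M n n * w n → u n ≈ w n
    cancel n eq = begin
      u n                  ≈⟨ *-identityˡ _ ⟨
      1# * u n             ≈⟨ *-congʳ (dM≈1 n) ⟨
      (d n * M n n) * u n  ≈⟨ *-assoc _ _ _ ⟩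
      d n * (M n n * u n)  ≈⟨ *-congˡ eq ⟩
      d n * (M n n * w n)  ≈⟨ *-assoc _ _ _ ⟨
      (d n * M n n) * w n  ≈⟨ *-congʳ (dM≈1 n) ⟩
      1# * w n             ≈⟨ *-identityˡ _ ⟩
      w n                  ∎
    agree : ∀ n k → k ≤ n → u k ≈ w k
    agree zero    _ z≤n = cancel 0 (Mu≈Mw 0)
    agree (suc n) k k≤1+n with ℕₚ.m≤n⇒m<n∨m≡n k≤1+n
    ... | inj₁ (s≤s k≤n) = agree n k k≤n
    ... | inj₂ ≡.refl     = cancel (suc n) (+-cancelˡ _ _ _
      (trans (+-congʳ (∑≤-cong n (λ k k≤n → *-congˡ (sym (agree n k k≤n))))) (Mu≈Mw (suc n))))

  ⊙-leftInverse : ∀ {A B} → LowerTriangular B → LeftInverse A B →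
                  ∀ {U V} → (∀ n → U n ≈ (B ⊙ V) n) → ∀ n → V n ≈ (A ⊙ U) n
  ⊙-leftInverse {A} {B} B-lower A⊛B≈I {U} {V} U≈BV n = sym (begin
    (A ⊙ U) n            ≈⟨ ∑≤-cong n (λ j _ → *-congˡ (U≈BV j)) ⟩
    (A ⊙ B ⊙ V) n        ≈⟨ ⊙-⊛ B-lower A V n ⟩
    ((A ⊛ B) ⊙ V) n      ≈⟨ ⊙-identity A⊛B≈I V n ⟩
    V n                  ∎)

  inversion : ∀ {A B} → LowerTriangular B → LeftInverse A B → ∀ U V →
              (∀ n → U n ≈ (B ⊙ V) n) ⇔ (∀ n → V n ≈ (A ⊙ U) n)
  inversion {A} {B} B-lower A⊛B≈I U V = mk⇔ (⊙-leftInverse B-lower A⊛B≈I) backward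
    where
    backward : (∀ n → V n ≈ (A ⊙ U) n) → ∀ n → U n ≈ (B ⊙ V) n
    backward V≈AU = ⊙-injective (λ n → B n n)
      (λ n → trans (*-comm _ _) (diagonal-inverse B-lower A⊛B≈I n))
      (λ n → trans (sym (V≈AU n)) (⊙-leftInverse B-lower A⊛B≈I (λ _ → refl) n))

module Homomorphic {p pℓ r rℓ : Level} (P : CommutativeRing p pℓ) (R : CommutativeRing r rℓ)
  (ι : CommutativeRing.Carrier P → CommutativeRing.Carrier R)
  (ι-hom : RingMorphisms.IsRingHomomorphism
             (CommutativeRing.rawRing P) (CommutativeRing.rawRing R) ι) where
  private
    module P = CommutativeRing P
    module OpsP = RingOps P
    module TriP = Triangular P
  open CommutativeRing R
  open RingOps R
  open Triangular R
  open RingMorphisms.IsRingHomomorphism ι-hom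

  ι-∑≤ : ∀ n (f : ℕ → P.Carrier) → ι (OpsP.∑≤ n f) ≈ ∑≤ n (ι ∘ f)
  ι-∑≤ zero    f = refl
  ι-∑≤ (suc n) f = trans (+-homo _ _) (+-congʳ (ι-∑≤ n f))

  ι-⊛ : ∀ A B n k → ι ((A TriP.⊛ B) n k) ≈ ((λ i j → ι (A i j)) ⊛ (λ i j → ι (B i j))) n k
  ι-⊛ A B n k = trans (ι-∑≤ n _) (Sums.∑≤-cong R n (λ j _ → *-homo _ _))

  map-LowerTriangular : ∀ {B} → TriP.LowerTriangular B → LowerTriangular (λ i j → ι (B i j))
  map-LowerTriangular B-lower j k j<k = trans (⟦⟧-cong (B-lower j k j<k)) 0#-homo

  map-LeftInverse : ∀ {A B} → TriP.LeftInverse A B →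
                    LeftInverse (λ i j → ι (A i j)) (λ i j → ι (B i j))
  map-LeftInverse {A} {B} A⊛B≈I = record
    { diagonal      = λ n → trans (sym (ι-⊛ A B n n)) (trans (⟦⟧-cong (diagonal n)) 1#-homo)
    ; belowDiagonal = λ n k k<n →
        trans (sym (ι-⊛ A B n k)) (trans (⟦⟧-cong (belowDiagonal n k k<n)) 0#-homo)
    }
    where open TriP.LeftInverse A⊛B≈I

module Exponents where
  open ≡ using (refl; cong; sym; trans)
  open import Data.Nat using (_+_; _*_; _!)

  zeros : ℕ → List ℕ
  zeros k = replicate k 0

  -- Exponent lists of the monomials X_{1+m} and X_1^{1+k} (the head is the exponent of X_1).
  unitAt : ℕ → List ℕ
  unitAt zero    = 1 ∷ []
  unitAt (suc m) = 0 ∷ unitAt m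

  atHead : ℕ → List ℕ
  atHead k = suc k ∷ zeros k

  zeros-≤ : ∀ b k → All (_≤ b) (zeros k)
  zeros-≤ b zero    = []
  zeros-≤ b (suc k) = z≤n ∷ zeros-≤ b k

  sumR-zeros : ∀ k → sumR (zeros k) ≡ 0
  sumR-zeros zero    = refl
  sumR-zeros (suc k) = sumR-zeros k

  weightR-zeros : ∀ i k → weightR i (zeros k) ≡ 0
  weightR-zeros i zero    = refl
  weightR-zeros i (suc k) = ≡.cong₂ _+_ (ℕₚ.*-zeroʳ i) (weightR-zeros (suc i) k)

  denom-zeros : ∀ i k → denom i (zeros k) ≡ 1
  denom-zeros i zero    = refl
  denom-zeros i (suc k) = trans (ℕₚ.+-identityʳ _) (denom-zeros (suc i) k)

  sumR≡0⇒zeros : ∀ rs → sumR rs ≡ 0 → rs ≡ zeros (length rs)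
  sumR≡0⇒zeros []       _  = refl
  sumR≡0⇒zeros (r ∷ rs) eq rewrite ℕₚ.m+n≡0⇒m≡0 r eq =
    cong (0 ∷_) (sumR≡0⇒zeros rs (ℕₚ.m+n≡0⇒n≡0 r eq))

  weightR-suc : ∀ i rs → weightR (suc i) rs ≡ sumR rs + weightR i rs
  weightR-suc i []       = refl
  weightR-suc i (r ∷ rs) rewrite weightR-suc (suc i) rs = trans (ℕₚ.+-assoc r (i * r) _)
    (trans (cong (r +_) (swap (i * r) (sumR rs) _)) (sym (ℕₚ.+-assoc r (sumR rs) _)))
    where
    swap : ∀ a b d → a + (b + d) ≡ b + (a + d)
    swap a b d = trans (sym (ℕₚ.+-assoc a b d))
      (trans (cong (_+ d) (ℕₚ.+-comm a b)) (ℕₚ.+-assoc b a d))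

  length-unitAt : ∀ m → length (unitAt m) ≡ suc m
  length-unitAt zero    = refl
  length-unitAt (suc m) = cong suc (length-unitAt m)

  unitAt-≤ : ∀ b m → 1 ≤ b → All (_≤ b) (unitAt m)
  unitAt-≤ b zero    1≤b = 1≤b ∷ []
  unitAt-≤ b (suc m) 1≤b = z≤n ∷ unitAt-≤ b m 1≤b

  sumR-unitAt : ∀ m → sumR (unitAt m) ≡ 1
  sumR-unitAt zero    = refl
  sumR-unitAt (suc m) = sumR-unitAt m

  weightR-unitAt : ∀ i m → weightR i (unitAt m) ≡ i + m
  weightR-unitAt i zero    = cong (_+ 0) (ℕₚ.*-identityʳ i)
  weightR-unitAt i (suc m) = trans (cong (_+ weightR (suc i) (unitAt m)) (ℕₚ.*-zeroʳ i))
    (trans (weightR-unitAt (suc i) m) (sym (ℕₚ.+-suc i m)))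

  denom-unitAt : ∀ i m → denom i (unitAt m) ≡ (i + m) !
  denom-unitAt i zero    = trans (ℕₚ.*-identityʳ _)
    (trans (ℕₚ.+-identityʳ _) (trans (ℕₚ.*-identityʳ _) (cong _! (sym (ℕₚ.+-identityʳ i)))))
  denom-unitAt i (suc m) = trans (ℕₚ.+-identityʳ _)
    (trans (denom-unitAt (suc i) m) (cong _! (sym (ℕₚ.+-suc i m))))

  unitAt-unique : ∀ m i rs → length rs ≡ suc m → sumR rs ≡ 1 → weightR i rs ≡ i + m →
                  rs ≡ unitAt m
  unitAt-unique zero    i (0 ∷ [])      _ ()   _
  unitAt-unique (suc m) i (0 ∷ rs)      |rs| Σrs w rewrite ℕₚ.*-zeroʳ i =
    cong (0 ∷_) (unitAt-unique m (suc i) rs (ℕₚ.suc-injective |rs|) Σrs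
      (trans w (ℕₚ.+-suc i m)))
  unitAt-unique zero    i (1 ∷ [])      _    _   _ = refl
  unitAt-unique (suc m) i (1 ∷ rs)      _    Σrs w = ⊥-elim (ℕₚ.m≢1+m+n i
    (trans (sym (ℕₚ.+-identityʳ i))
      (trans (sym (≡.cong₂ _+_ (ℕₚ.*-identityʳ i) weight-tail≡0)) (trans w (ℕₚ.+-suc i m)))))
    where
    weight-tail≡0 : weightR (suc i) rs ≡ 0
    weight-tail≡0 = trans (cong (weightR (suc i)) (sumR≡0⇒zeros rs (ℕₚ.suc-injective Σrs)))
      (weightR-zeros (suc i) (length rs))
  unitAt-unique zero    i (1 ∷ _ ∷ _)   ()
  unitAt-unique _       i (suc (suc _) ∷ _) _ ()

  sumR-atHead : ∀ k → sumR (atHead k) ≡ suc k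
  sumR-atHead k = trans (cong (suc k +_) (sumR-zeros k)) (ℕₚ.+-identityʳ _)

  weightR-atHead : ∀ k → weightR 1 (atHead k) ≡ suc k
  weightR-atHead k =
    trans (≡.cong₂ _+_ (ℕₚ.*-identityˡ (suc k)) (weightR-zeros 2 k)) (ℕₚ.+-identityʳ _)

  denom-atHead : ∀ k → denom 1 (atHead k) ≡ suc k !
  denom-atHead k rewrite denom-zeros 2 k | ℕₚ.^-zeroˡ (suc k) =
    trans (ℕₚ.*-identityʳ _) (ℕₚ.*-identityʳ _)

  -- weightR 1 (r ∷ rs) = sumR (r ∷ rs) + weightR 1 rs, so the tail has weight, hence sum, 0.
  atHead-unique : ∀ k rs → length rs ≡ suc k → sumR rs ≡ suc k → weightR 1 rs ≡ suc k →
                  rs ≡ atHead k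
  atHead-unique k (r ∷ rs) |rs| Σrs w = ≡.cong₂ _∷_ r≡1+k
    (trans (sumR≡0⇒zeros rs Σtail≡0) (cong zeros (ℕₚ.suc-injective |rs|)))
    where
    1+k≡1+k+wtail : suc k ≡ suc k + weightR 1 rs
    1+k≡1+k+wtail = trans (sym w)
      (trans (weightR-suc 0 (r ∷ rs)) (cong (_+ weightR 1 rs) Σrs))
    Σtail≡0 : sumR rs ≡ 0
    Σtail≡0 = ℕₚ.m+n≡0⇒m≡0 (sumR rs) (trans (sym (weightR-suc 0 rs))
      (ℕₚ.+-cancelˡ-≡ (suc k) _ 0 (trans (sym 1+k≡1+k+wtail) (sym (ℕₚ.+-identityʳ _)))))
    r≡1+k : r ≡ suc k
    r≡1+k = trans (sym (ℕₚ.+-identityʳ r)) (trans (cong (r +_) (sym Σtail≡0)) Σrs)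

module BellValues {c ℓ : Level} (R : CommutativeRing c ℓ) where
  open CommutativeRing R
  open RingOps R
  open Sums R
  open Powers R
  open Triangular R
  open Exponents
  open import Relation.Binary.Reasoning.Setoid setoid

  private
    if-∧-vanish : ∀ {A B : Set} (a? : Dec A) (b? : Dec B) {v} → ¬ (A × B) →
                  (if ⌊ a? ⌋ ∧ ⌊ b? ⌋ then v else 0#) ≈ 0#
    if-∧-vanish (yes a) (yes b) ¬ab = ⊥-elim (¬ab (a , b))
    if-∧-vanish (yes _) (no _)  _   = refl
    if-∧-vanish (no _)  _       _   = refl

    if-∧-select : ∀ {A B : Set} (a? : Dec A) (b? : Dec B) {v} → A → B →
                  (if ⌊ a? ⌋ ∧ ⌊ b? ⌋ then v else 0#) ≈ v
    if-∧-select (yes _) (yes _) _ _ = refl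
    if-∧-select (yes _) (no ¬b) _ b = ⊥-elim (¬b b)
    if-∧-select (no ¬a) _       a _ = ⊥-elim (¬a a)

    if-cong : ∀ b {u v} → u ≈ v → (if b then u else 0#) ≈ (if b then v else 0#)
    if-cong true  u≈v = u≈v
    if-cong false u≈v = refl

    /-self : ∀ {a d} .{{_ : ℕ.NonZero d}} → d ≡ a → a / d ≡ 1
    /-self {a} ≡.refl = n/n≡1 a

  ·ℕ-congʳ : ∀ n {a b} → a ≈ b → n ·ℕ a ≈ n ·ℕ b
  ·ℕ-congʳ zero    a≈b = refl
  ·ℕ-congʳ (suc n) a≈b = +-cong a≈b (·ℕ-congʳ n a≈b)

  mono-cong : ∀ {y z : ℕ → Carrier} → (∀ i → y (suc i) ≈ z (suc i)) →
              ∀ i rs → mono y (suc i) rs ≈ mono z (suc i) rs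
  mono-cong y≈z i []       = refl
  mono-cong y≈z i (r ∷ rs) = *-cong (^-congˡ r (y≈z i)) (mono-cong y≈z (suc i) rs)

  mono-zeros : ∀ y i k → mono y i (zeros k) ≈ 1#
  mono-zeros y i zero    = refl
  mono-zeros y i (suc k) = trans (*-identityˡ _) (mono-zeros y (suc i) k)

  mono-unitAt : ∀ y i m → mono y i (unitAt m) ≈ y (i ℕ.+ m)
  mono-unitAt y i zero    = trans (*-identityʳ _) (trans (*-identityʳ _)
    (reflexive (≡.cong y (≡.sym (ℕₚ.+-identityʳ i)))))
  mono-unitAt y i (suc m) = trans (*-identityˡ _)
    (trans (mono-unitAt y (suc i) m) (reflexive (≡.cong y (≡.sym (ℕₚ.+-suc i m)))))

  bellCoeff≡1 : ∀ n t → denom 1 t ≡ n ℕ.! → bellCoeff n t ≡ 1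
  bellCoeff≡1 n t = /-self {{denom≢0 1 t}}

  bellSum-single : ∀ y n k (t : List ℕ) → length t ≡ n → All (_≤ n) t →
    sumR t ≡ k → weightR 1 t ≡ n →
    (∀ rs → length rs ≡ n → sumR rs ≡ k → weightR 1 rs ≡ n → rs ≡ t) →
    bellSum y n k ≈ bellCoeff n t ·ℕ mono y 1 t
  bellSum-single y n k t |t| t≤n Σt wt unique = trans
    (∑L-allLists-single n n t _ |t| t≤n (λ rs |rs| rs≢t →
      if-∧-vanish (sumR rs ≟ k) (weightR 1 rs ≟ n) (λ (Σrs , wrs) → rs≢t (unique rs |rs| Σrs wrs))))
    (if-∧-select (sumR t ≟ k) (weightR 1 t ≟ n) Σt wt)

  Bell≡bellSum : ∀ y n k → suc k ≤ n → Bell y n (suc k) ≡ bellSum y n (suc k)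
  Bell≡bellSum y (suc n) k k<n with suc k ≤? suc n
  ... | yes _  = ≡.refl
  ... | no k≮n = ⊥-elim (k≮n k<n)

  Bell-lowerTriangular : ∀ y → LowerTriangular (Bell y)
  Bell-lowerTriangular y zero    (suc k) _   = refl
  Bell-lowerTriangular y (suc n) (suc k) n<k with suc k ≤? suc n
  ... | yes k≤n = ⊥-elim (ℕₚ.<⇒≱ n<k k≤n)
  ... | no _    = refl

  Bell-cong : ∀ {y z : ℕ → Carrier} → (∀ i → y (suc i) ≈ z (suc i)) →
              ∀ n k → Bell y n k ≈ Bell z n k
  Bell-cong y≈z zero    zero    = refl
  Bell-cong y≈z (suc n) zero    = refl
  Bell-cong y≈z zero    (suc k) = refl
  Bell-cong y≈z (suc n) (suc k) with suc k ≤? suc n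
  ... | yes _ = ∑L-cong (allLists (suc n) (suc n)) λ rs →
                  if-cong _ (·ℕ-congʳ (bellCoeff (suc n) rs) (mono-cong y≈z 0 rs))
  ... | no _  = refl

  Bell-firstColumn : ∀ y m → Bell y (suc m) 1 ≈ y (suc m)
  Bell-firstColumn y m = begin
    Bell y (suc m) 1
      ≡⟨ Bell≡bellSum y (suc m) 0 (s≤s z≤n) ⟩
    bellSum y (suc m) 1
      ≈⟨ bellSum-single y (suc m) 1 (unitAt m) (length-unitAt m) (unitAt-≤ (suc m) m (s≤s z≤n))
           (sumR-unitAt m) (weightR-unitAt 1 m) (λ rs |rs| Σrs wrs → unitAt-unique m 1 rs |rs| Σrs wrs) ⟩
    bellCoeff (suc m) (unitAt m) ·ℕ mono y 1 (unitAt m)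
      ≡⟨ ≡.cong (_·ℕ mono y 1 (unitAt m)) (bellCoeff≡1 (suc m) (unitAt m) (denom-unitAt 1 m)) ⟩
    1 ·ℕ mono y 1 (unitAt m)
      ≈⟨ +-identityʳ _ ⟩
    mono y 1 (unitAt m)
      ≈⟨ mono-unitAt y 1 m ⟩
    y (suc m)
      ∎

  Bell-diagonal : ∀ y k → Bell y k k ≈ y 1 ^ k
  Bell-diagonal y zero    = refl
  Bell-diagonal y (suc k) = begin
    Bell y (suc k) (suc k)
      ≡⟨ Bell≡bellSum y (suc k) k ℕₚ.≤-refl ⟩
    bellSum y (suc k) (suc k)
      ≈⟨ bellSum-single y (suc k) (suc k) (atHead k) (≡.cong suc (length-replicate k))
           (ℕₚ.≤-refl ∷ zeros-≤ (suc k) k) (sumR-atHead k) (weightR-atHead k) (atHead-unique k) ⟩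
    bellCoeff (suc k) (atHead k) ·ℕ mono y 1 (atHead k)
      ≡⟨ ≡.cong (_·ℕ mono y 1 (atHead k)) (bellCoeff≡1 (suc k) (atHead k) (denom-atHead k)) ⟩
    1 ·ℕ (y 1 ^ suc k * mono y 2 (zeros k))
      ≈⟨ +-identityʳ _ ⟩
    y 1 ^ suc k * mono y 2 (zeros k)
      ≈⟨ *-congˡ (mono-zeros y 2 k) ⟩
    y 1 ^ suc k * 1#
      ≈⟨ *-identityʳ _ ⟩
    y 1 ^ suc k
      ∎

  BRepresentable⇒Bell : ∀ {Q} → BRepresentable Q → ∀ j k → Q j k ≈ Bell (λ i → Q i 1) j k
  BRepresentable⇒Bell {Q} Q-rep = Q≈Bell
    where
    open BRepresentable Q-rep
    H≈Q-firstColumn : ∀ i → H (suc i) ≈ Q (suc i) 1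
    H≈Q-firstColumn i = sym (trans (repr (suc i) 1 (s≤s z≤n) (s≤s z≤n)) (Bell-firstColumn H i))
    Q≈Bell : ∀ j k → Q j k ≈ Bell (λ i → Q i 1) j k
    Q≈Bell zero    zero    = q00
    Q≈Bell (suc j) zero    = qn0 j
    Q≈Bell j       (suc k) with suc k ≤? j
    ... | yes k<j = trans (repr j (suc k) (s≤s z≤n) k<j) (Bell-cong H≈Q-firstColumn j (suc k))
    ... | no  k≮j = trans (upper0 j (suc k) (ℕₚ.≰⇒> k≮j))
                      (sym (Bell-lowerTriangular _ j (suc k) (ℕₚ.≰⇒> k≮j)))

module OrthogonalCompanion {c ℓ : Level} (R : CommutativeRing c ℓ) where
  open CommutativeRing R
  open RingOps R
  open Sums R
  open Powers R
  open Triangular R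
  open BellValues R
  open import Algebra.Properties.Ring ring using (-‿distribˡ-*)
  open import Relation.Binary.Reasoning.Setoid setoid

  module _ (x : ℕ → Carrier) (xinv : Carrier) (x₁xinv≈1 : x 1 * xinv ≈ 1#) where

    private module Row (n : ℕ) where
      -- a e is the entry A_{n, n ∸ e}: Atab n d fills the row from the diagonal outwards.
      a : ℕ → Carrier
      a e = Atab x xinv n e e

      Atab-stable : ∀ d e → e ≤ d → Atab x xinv n d e ≡ a e
      Atab-stable zero    _ z≤n  = ≡.refl
      Atab-stable (suc d) e e≤1+d with ℕₚ.m≤n⇒m<n∨m≡n e≤1+d
      ... | inj₂ ≡.refl     = ≡.refl
      ... | inj₁ (s≤s e≤d) with e ≤? d
      ...   | yes _   = Atab-stable d e e≤d
      ...   | no e≰d = ⊥-elim (e≰d e≤d)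

      a-zero : a 0 ≡ xinv ^ n
      a-zero with 0 ≟ 0
      ... | yes _  = ≡.refl
      ... | no 0≢0 = ⊥-elim (0≢0 ≡.refl)

      a-suc : ∀ d → a (suc d) ≡
        - (xinv ^ (n ∸ suc d) * ∑≤ d (λ e → Atab x xinv n d e * Bell x (n ∸ e) (n ∸ suc d)))
      a-suc d with suc d ≤? d | suc d ≟ suc d
      ... | yes d<d | _          = ⊥-elim (ℕₚ.<-irrefl ≡.refl d<d)
      ... | no _    | yes _      = ≡.refl
      ... | no _    | no d≢d     = ⊥-elim (d≢d ≡.refl)

      AFam≡a : ∀ j → j ≤ n → AFam x xinv n j ≡ a (n ∸ j)
      AFam≡a j j≤n with j ≤? n
      ... | yes _   = ≡.refl
      ... | no j≰n = ⊥-elim (j≰n j≤n)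

      column : ℕ → Carrier
      column d = ∑≤ d (λ e → a e * Bell x (n ∸ e) (n ∸ d))

      column-zero : column 0 ≈ 1#
      column-zero = trans (*-cong (reflexive a-zero) (Bell-diagonal x n))
        (^-inverse n (trans (*-comm _ _) x₁xinv≈1))

      column-suc : ∀ d → column (suc d) ≈ 0#
      column-suc d = begin
        S + a (suc d) * Bell x m m            ≈⟨ +-congˡ (*-cong (reflexive (a-suc d)) (Bell-diagonal x m)) ⟩
        S + - (xinv ^ m * S′) * x 1 ^ m       ≈⟨ +-congˡ (*-congʳ (-‿cong (*-congˡ S′≈S))) ⟩
        S + - (xinv ^ m * S) * x 1 ^ m        ≈⟨ +-congˡ (-‿distribˡ-* _ _) ⟨
        S + - ((xinv ^ m * S) * x 1 ^ m)      ≈⟨ +-congˡ (-‿cong xinvᵐSx₁ᵐ≈S) ⟩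
        S + - S                               ≈⟨ -‿inverseʳ S ⟩
        0#                                    ∎
        where
        m = n ∸ suc d
        S = ∑≤ d (λ e → a e * Bell x (n ∸ e) m)
        S′ = ∑≤ d (λ e → Atab x xinv n d e * Bell x (n ∸ e) m)
        S′≈S : S′ ≈ S
        S′≈S = ∑≤-cong d (λ e e≤d → *-congʳ (reflexive (Atab-stable d e e≤d)))
        xinvᵐSx₁ᵐ≈S : (xinv ^ m * S) * x 1 ^ m ≈ S
        xinvᵐSx₁ᵐ≈S = begin
          (xinv ^ m * S) * x 1 ^ m   ≈⟨ *-congʳ (*-comm _ _) ⟩
          (S * xinv ^ m) * x 1 ^ m   ≈⟨ *-assoc _ _ _ ⟩
          S * (xinv ^ m * x 1 ^ m)   ≈⟨ *-congˡ (^-inverse m (trans (*-comm _ _) x₁xinv≈1)) ⟩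
          S * 1#                     ≈⟨ *-identityʳ S ⟩
          S                          ∎

      ⊛≈column : ∀ k → k ≤ n → (AFam x xinv ⊛ Bell x) n k ≈ column (n ∸ k)
      ⊛≈column k k≤n = begin
        ∑≤ n (λ j → AFam x xinv n j * Bell x j k)
          ≈⟨ ∑≤-reverse n _ ⟩
        ∑≤ n (λ e → AFam x xinv n (n ∸ e) * Bell x (n ∸ e) k)
          ≈⟨ ∑≤-cong n (λ e e≤n → *-congʳ (reflexive
               (≡.trans (AFam≡a (n ∸ e) (ℕₚ.m∸n≤m n e)) (≡.cong a (ℕₚ.m∸[m∸n]≡n e≤n))))) ⟩
        ∑≤ n (λ e → a e * Bell x (n ∸ e) k)
          ≈⟨ ∑≤-truncate (n ∸ k) n (ℕₚ.m∸n≤m n k) (λ e n∸k<e e≤n →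
               trans (*-congˡ (Bell-lowerTriangular x (n ∸ e) k
                 (≡.subst (n ∸ e <_) (ℕₚ.m∸[m∸n]≡n k≤n) (ℕₚ.∸-monoʳ-< n∸k<e e≤n))))
               (zeroʳ _)) ⟩
        ∑≤ (n ∸ k) (λ e → a e * Bell x (n ∸ e) k)
          ≡⟨ ≡.cong (λ j → ∑≤ (n ∸ k) (λ e → a e * Bell x (n ∸ e) j)) (ℕₚ.m∸[m∸n]≡n k≤n) ⟨
        column (n ∸ k)
          ∎

    open Row

    AFam-leftInverse : LeftInverse (AFam x xinv) (Bell x)
    AFam-leftInverse = record
      { diagonal      = λ n → trans (⊛≈column n n ℕₚ.≤-refl)
          (≡.subst (λ d → column n d ≈ 1#) (≡.sym (ℕₚ.n∸n≡0 n)) (column-zero n))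
      ; belowDiagonal = λ n k k<n → trans (⊛≈column n k (ℕₚ.<⇒≤ k<n))
          (≡.subst (λ d → column n d ≈ 0#) (≡.sym (ℕₚ.+-∸-assoc 1 k<n)) (column-suc n (n ∸ suc k)))
      }

proposition5p5 :
  ∀ {k kℓ p pℓ r rℓ}
  (K : CommutativeRing k kℓ) → IsField K → CharZero K →
  (P : CommutativeRing p pℓ)
  (ιK : CommutativeRing.Carrier K → CommutativeRing.Carrier P)
  (X : ℕ → CommutativeRing.Carrier P) (Xinv : CommutativeRing.Carrier P) →
  IsLaurentPolyRing K P ιK X Xinv →
  (R : CommutativeRing r rℓ) (ι : CommutativeRing.Carrier P → CommutativeRing.Carrier R) →
  IsOverring P R ι →
  (U V : ℕ → CommutativeRing.Carrier R) →
  (Q : ℕ → ℕ → CommutativeRing.Carrier P) →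
  RingOps.BRepresentable P Q → RingOps.Regular P Q →
  (q11inv : CommutativeRing.Carrier P) →
  CommutativeRing._≈_ P (CommutativeRing._*_ P (Q 1 1) q11inv) (CommutativeRing.1# P) →
  Expansion P R ι Q U V ⇔ Expansion P R ι (OrthCompanion P Q q11inv) V U
proposition5p5 _ _ _ P _ _ _ _ R ι ι-mono U V Q Q-rep _ q11inv Q₁₁q11inv≈1 =
  Triangular.inversion R (map-LowerTriangular (RingOps.BRepresentable.upper0 Q-rep))
    (map-LeftInverse Q⊥-leftInverse) U V
  where
  open RingMorphisms.IsRingMonomorphism ι-mono using (isRingHomomorphism)
  open Homomorphic P R ι isRingHomomorphism
  Q⊥-leftInverse : Triangular.LeftInverse P (OrthCompanion P Q q11inv) Q
  Q⊥-leftInverse = Triangular.LeftInverse-congʳ P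
    (λ j k → CommutativeRing.sym P (BellValues.BRepresentable⇒Bell P Q-rep j k))
    (OrthogonalCompanion.AFam-leftInverse P (λ j → Q j 1) q11inv Q₁₁q11inv≈1)
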